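{- Let $n > 1$ be an integer, let $p$ be the largest prime factor of $n$, and let $P$ be the product of all (distinct) prime factors of $n$. Then $f(n) \leqslant \max\{p-1,\ n/P\}$.
   Context: For an integer $n>1$, $\mathcal{A}(n) = \{a \in \mathbb{Z}^{+} : a < n,\ \gcd(a,n)=1\}$, and $f(n)$ denotes the maximum possible length among all arithmetic progressions contained in $\mathcal{A}(n)$. An arithmetic progression of length $s$ is a sequence $a_0, a_0+q, \dots, a_0+(s-1)q$ of integers with common difference $q$ a positive integer. -}

module Defs where

open import Data.Nat using (ℕ; zero; suc; _+_; _*_; _<_; _≤_)
open import Data.Nat.Divisibility using (_∣_; _∣?_)
open import Data.Nat.Coprimality using (Coprime)
open import Data.Nat.Primality using (Prime; prime?)
open import Data.Product using (_×_)
open import Relation.Nullary.Decidable using (does)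
open import Data.Bool using (if_then_else_; _∧_)

InA : ℕ → ℕ → Set
InA n a = 0 < a × a < n × Coprime a n

APin : ℕ → (a0 q s : ℕ) → Set
APin n a0 q s = 0 < q × (∀ i → i < s → InA n (a0 + i * q))

radUpTo : ℕ → ℕ → ℕ
radUpTo n zero = 1
radUpTo n (suc k) =
  (if does (prime? (suc k)) ∧ does (suc k ∣? n) then suc k else 1) * radUpTo n k

-- P = product of all distinct prime factors of n (for n ≥ 1 they are all ≤ n)
rad : ℕ → ℕ
rad n = radUpTo n n

LargestPrimeFactor : ℕ → ℕ → Set
LargestPrimeFactor n p = Prime p × p ∣ n × (∀ r → Prime r → r ∣ n → r ≤ p)

open import Data.Nat using (NonZero)
open import Data.Nat.Properties using (m*n≢0)
open import Data.Nat.Base using (nonZero)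

radUpTo-nz : ∀ n k → NonZero (radUpTo n k)
radUpTo-nz n zero = _
radUpTo-nz n (suc k) with does (prime? (suc k)) ∧ does (suc k ∣? n)
... | Data.Bool.true  = m*n≢0 (suc k) (radUpTo n k) {{_}} {{radUpTo-nz n k}}
... | Data.Bool.false = m*n≢0 1 (radUpTo n k) {{_}} {{radUpTo-nz n k}}

rad-nonZero : ∀ n → NonZero (rad n)
rad-nonZero n = radUpTo-nz n n

{-# OPTIONS --safe #-}
module Submission where

-- If some prime r ∣ n does not divide the common difference q, the terms a₀ + i q with
-- i < r run through every residue class mod r, so one of them is divisible by r and
-- cannot be coprime to n: the progression has fewer than r ≤ p terms. Otherwise every
-- prime factor of n divides q, so P ∣ q, and the progression fits below n with
-- difference at least P, whence it has at most n / P terms.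

open import Defs
open import Data.Nat using (ℕ; _<_; _≤_; _∸_; _⊔_; _/_)
open import Data.Nat.Base using (zero; suc; _+_; _*_; _%_; NonZero; z≤n; s≤s; >-nonZero; nonTrivial⇒≢1)
open import Data.Nat.Properties
open import Data.Nat.Divisibility
open import Data.Nat.DivMod using (m≡m%n+[m/n]*n; m/n*n≡m; m%n<n)
open import Data.Nat.Coprimality using (Coprime; coprime-divisor; coprime-Bézout)
open import Data.Nat.Primality using (Prime; prime?; euclidsLemma; prime⇒irreducible; prime⇒nonZero; prime⇒nonTrivial)
open import Data.Nat.GCD using (module Bézout)
open import Data.Nat.Tactic.RingSolver using (solve-∀)
open import Data.Product using (∃-syntax; _×_; _,_)
open import Data.Sum using (_⊎_; inj₁; inj₂; [_,_])
open import Data.Bool using (true; false)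
open import Data.Empty using (⊥-elim)
open import Relation.Nullary using (¬_; yes; no; does; proof; ofʸ)
open import Relation.Binary.PropositionalEquality using (_≡_; _≢_; refl; sym; trans; cong; subst; module ≡-Reasoning)

prime≢1 : ∀ {r} → Prime r → r ≢ 1
prime≢1 pr = nonTrivial⇒≢1 {{prime⇒nonTrivial pr}}

prime≢0 : ∀ {r} → Prime r → r ≢ 0
prime≢0 pr refl = NonZero.nonZero (prime⇒nonZero pr)

prime∤⇒coprime : ∀ {r m} → Prime r → ¬ r ∣ m → Coprime r m
prime∤⇒coprime pr r∤m (d∣r , d∣m) with prime⇒irreducible pr d∣r
... | inj₁ d≡1 = d≡1
... | inj₂ refl = ⊥-elim (r∤m d∣m)

coprime∧∣∧∣⇒*∣ : ∀ {m n k} → Coprime m n → m ∣ k → n ∣ k → m * n ∣ k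
coprime∧∣∧∣⇒*∣ {m} {n} {k} cop m∣k (divides c k≡c*n) =
  divides (quotient m∣c) (begin
    k                         ≡⟨ k≡c*n ⟩
    c * n                     ≡⟨ cong (_* n) (_∣_.equality m∣c) ⟩
    quotient m∣c * m * n      ≡⟨ *-assoc (quotient m∣c) m n ⟩
    quotient m∣c * (m * n)    ∎)
  where
  open ≡-Reasoning
  m∣c : m ∣ c
  m∣c = coprime-divisor cop (subst (m ∣_) (trans k≡c*n (*-comm c n)) m∣k)

radUpTo-suc : ∀ n k → (Prime (suc k) × suc k ∣ n × radUpTo n (suc k) ≡ suc k * radUpTo n k)
                      ⊎ radUpTo n (suc k) ≡ radUpTo n k
radUpTo-suc n k with does (prime? (suc k)) | proof (prime? (suc k)) | does (suc k ∣? n) | proof (suc k ∣? n)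
... | true  | ofʸ k+1-prime | true  | ofʸ k+1∣n = inj₁ (k+1-prime , k+1∣n , refl)
... | true  | _             | false | _         = inj₂ (*-identityˡ (radUpTo n k))
... | false | _             | _     | _         = inj₂ (*-identityˡ (radUpTo n k))

prime∤radUpTo : ∀ n k {r} → Prime r → k < r → ¬ r ∣ radUpTo n k
prime∤radUpTo n zero pr _ r∣1 = prime≢1 pr (∣1⇒≡1 r∣1)
prime∤radUpTo n (suc k) {r} pr k<r = by-cases (radUpTo-suc n k)
  where
  r∤rest : ¬ r ∣ radUpTo n k
  r∤rest = prime∤radUpTo n k pr (<-trans (n<1+n k) k<r)
  by-cases : (Prime (suc k) × suc k ∣ n × radUpTo n (suc k) ≡ suc k * radUpTo n k)
             ⊎ radUpTo n (suc k) ≡ radUpTo n k →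
             ¬ r ∣ radUpTo n (suc k)
  by-cases (inj₂ same) r∣rad = r∤rest (subst (r ∣_) same r∣rad)
  by-cases (inj₁ (_ , _ , step)) r∣rad =
    [ (λ r∣k → <⇒≱ k<r (∣⇒≤ r∣k)) , r∤rest ] (euclidsLemma _ _ pr (subst (r ∣_) step r∣rad))

radUpTo∣⊎prime∤ : ∀ n q k → radUpTo n k ∣ q ⊎ ∃[ r ] (Prime r × r ∣ n × ¬ r ∣ q)
radUpTo∣⊎prime∤ n q zero = inj₁ (1∣ q)
radUpTo∣⊎prime∤ n q (suc k) with radUpTo∣⊎prime∤ n q k
... | inj₂ witness = inj₂ witness
... | inj₁ rest∣q with radUpTo-suc n k
...   | inj₂ same = inj₁ (subst (_∣ q) (sym same) rest∣q)
...   | inj₁ (pr , k∣n , step) with suc k ∣? q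
...     | no k∤q  = inj₂ (suc k , pr , k∣n , k∤q)
...     | yes k∣q = inj₁ (subst (_∣ q) (sym step) (coprime∧∣∧∣⇒*∣ coprime k∣q rest∣q))
  where coprime = prime∤⇒coprime pr (prime∤radUpTo n k pr (n<1+n k))

rad∣n : ∀ n → rad n ∣ n
rad∣n n with radUpTo∣⊎prime∤ n n n
... | inj₁ divides-n = divides-n
... | inj₂ (_ , _ , r∣n , r∤n) = ⊥-elim (r∤n r∣n)

-- The index is a0 times an inverse of -q modulo r, read off from a Bézout identity for r and q.
prime∣term : ∀ {r} a0 q → Prime r → ¬ r ∣ q → ∃[ i ] r ∣ a0 + i * q
prime∣term {zero} _ _ pr _ = ⊥-elim (prime≢0 pr refl)
prime∣term {r@(suc r-1)} a0 q pr r∤q with coprime-Bézout (prime∤⇒coprime pr r∤q)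
... | Bézout.+- x y 1+yq≡xr = y * a0 , divides (a0 * x) (begin
  a0 + y * a0 * q   ≡⟨ factor-a0 a0 y q ⟩
  a0 * (1 + y * q)  ≡⟨ cong (a0 *_) 1+yq≡xr ⟩
  a0 * (x * r)      ≡⟨ *-assoc a0 x r ⟨
  a0 * x * r        ∎)
  where
  open ≡-Reasoning
  factor-a0 : ∀ a0 y q → a0 + y * a0 * q ≡ a0 * (1 + y * q)
  factor-a0 = solve-∀
... | Bézout.-+ x y 1+xr≡yq = r-1 * a0 * y , divides (a0 + r-1 * a0 * x) (begin
  a0 + r-1 * a0 * y * q        ≡⟨ cong (a0 +_) (*-assoc (r-1 * a0) y q) ⟩
  a0 + r-1 * a0 * (y * q)      ≡⟨ cong (λ z → a0 + r-1 * a0 * z) 1+xr≡yq ⟨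
  a0 + r-1 * a0 * (1 + x * r)  ≡⟨ factor-r a0 r-1 x ⟩
  (a0 + r-1 * a0 * x) * r      ∎)
  where
  open ≡-Reasoning
  factor-r : ∀ a0 r-1 x → a0 + r-1 * a0 * (1 + x * suc r-1) ≡ (a0 + r-1 * a0 * x) * suc r-1
  factor-r = solve-∀

∣term⇒∣term[i%r] : ∀ {r} .{{_ : NonZero r}} a0 q i → r ∣ a0 + i * q → r ∣ a0 + (i % r) * q
∣term⇒∣term[i%r] {r} a0 q i r∣term = ∣m+n∣m⇒∣n (subst (r ∣_) split r∣term) (n∣m*n (i / r * q))
  where
  open ≡-Reasoning
  split : a0 + i * q ≡ i / r * q * r + (a0 + i % r * q)
  split = begin
    a0 + i * q                         ≡⟨ cong (λ j → a0 + j * q) (m≡m%n+[m/n]*n i r) ⟩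
    a0 + (i % r + i / r * r) * q       ≡⟨ regroup a0 q (i % r) (i / r) r ⟩
    i / r * q * r + (a0 + i % r * q)   ∎
    where
    regroup : ∀ a0 q m d r → a0 + (m + d * r) * q ≡ d * q * r + (a0 + m * q)
    regroup = solve-∀

prime∣term-below : ∀ {r} a0 q → Prime r → ¬ r ∣ q → ∃[ i ] i < r × r ∣ a0 + i * q
prime∣term-below {r} a0 q pr r∤q with prime∣term a0 q pr r∤q
... | i , r∣term = i % r , m%n<n i r , ∣term⇒∣term[i%r] a0 q i r∣term
  where instance _ = prime⇒nonZero pr

APin-length<prime : ∀ {n a0 q s r} → APin n a0 q s → Prime r → r ∣ n → ¬ r ∣ q → s < r
APin-length<prime {a0 = a0} {q} {s} {r} (_ , inA) pr r∣n r∤q with s <? r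
... | yes s<r = s<r
... | no s≮r with prime∣term-below a0 q pr r∤q
...   | i , i<r , r∣term with inA i (<-≤-trans i<r (≮⇒≥ s≮r))
...     | _ , _ , term⊥n = ⊥-elim (prime≢1 pr (term⊥n (r∣term , r∣n)))

APin-length≤quotient : ∀ {n a0 q s d} .{{_ : NonZero d}} → d ∣ n → d ∣ q → APin n a0 q s → s ≤ n / d
APin-length≤quotient {s = zero} _ _ _ = z≤n
APin-length≤quotient {n} {a0} {q} {suc t} {d} d∣n d∣q (0<q , inA) with inA t (n<1+n t) | inA 0 (s≤s z≤n)
... | _ , last<n , _ | 0<a0+0 , _ , _ = *-cancelʳ-< d t (n / d) (begin-strict
  t * d          ≤⟨ *-monoʳ-≤ t (∣⇒≤ {{>-nonZero 0<q}} d∣q) ⟩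
  t * q          <⟨ m<n+m (t * q) 0<a0 ⟩
  a0 + t * q     <⟨ last<n ⟩
  n              ≡⟨ m/n*n≡m d∣n ⟨
  n / d * d      ∎)
  where
  open ≤-Reasoning
  0<a0 : 0 < a0
  0<a0 = subst (0 <_) (+-identityʳ a0) 0<a0+0

lemma2p3 : ∀ (n p : ℕ) → 1 < n → LargestPrimeFactor n p →
    ∀ (a0 q s : ℕ) → APin n a0 q s → s ≤ (p ∸ 1) ⊔ (_/_ n (rad n) {{rad-nonZero n}})
lemma2p3 n p _ (_ , _ , largest) a0 q s ap with radUpTo∣⊎prime∤ n q n
... | inj₂ (r , pr , r∣n , r∤q) =
  m≤n⇒m≤n⊔o _ (∸-monoˡ-≤ 1 (<-≤-trans (APin-length<prime ap pr r∣n r∤q) (largest r pr r∣n)))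
... | inj₁ rad∣q =
  m≤n⇒m≤o⊔n (p ∸ 1) (APin-length≤quotient {{rad-nonZero n}} (rad∣n n) rad∣q ap)
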